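{- Let $(M,\mathrm{acc},\mathrm{rej})$ be a monitoring system that is maximal for the collection of all properties $2^{\mathrm{Act}^\infty}$, with witnessing monitors $m_P$. For every property $P\subseteq\mathrm{Act}^\infty$: (i) $m_P$ is sound for $P$; and (ii) if $m\in M$ is sound for $P$ and $f\in\mathrm{Act}^\infty$ with $\mathrm{acc}(m,f)$ (resp. $\mathrm{rej}(m,f)$), then $\mathrm{acc}(m_P,f)$ (resp. $\mathrm{rej}(m_P,f)$).
   Context: $\mathrm{Act}$ is a finite set of actions; $\mathrm{Act}^\infty=\mathrm{Act}^*\cup\mathrm{Act}^\omega$; a property is a subset of $\mathrm{Act}^\infty$. A finite trace $s$ positively (resp. negatively) determines $P$ if $sf\in P$ (resp. $sf\notin P$) for all $f\in\mathrm{Act}^\infty$. A monitoring system is a triple $(M,\mathrm{acc},\mathrm{rej})$ with $M$ nonempty and $\mathrm{acc},\mathrm{rej}\subseteq M\times\mathrm{Act}^\infty$ such that for every $m\in M$: (1) if $\mathrm{acc}(m,f)$ then $\mathrm{acc}(m,s)$ for some finite prefix $s$ of $f$, likewise for $\mathrm{rej}$; (2) if $\mathrm{acc}(m,s)$ for finite $s$ then $\mathrm{acc}(m,sf)$ for all $f$, likewise for $\mathrm{rej}$. It is maximal for a collection $C$ of properties if for every $P\in C$ there is $m_P\in M$ with: $\mathrm{acc}(m_P,f)$ iff $f$ has a finite prefix positively determining $P$, and $\mathrm{rej}(m_P,f)$ iff $f$ has a finite prefix negatively determining $P$. A monitor $m$ is sound for $P$ if $\mathrm{acc}(m,f)$ implies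 $f\in P$ and $\mathrm{rej}(m,f)$ implies $f\notin P$. -}

module Defs where

open import Data.Nat using (ℕ; zero; suc)
open import Data.Fin using (Fin)
open import Data.List using (List; []; _∷_; _++_)
open import Data.Sum using (_⊎_; inj₁; inj₂)
open import Data.Product using (Σ; ∃; _×_; _,_)
open import Relation.Nullary using (¬_)
open import Relation.Binary.PropositionalEquality using (_≡_)

module _ (k : ℕ) where

  Act : Set
  Act = Fin k

  -- Act^∞ = Act^* ∪ Act^ω : finite traces (lists) or infinite traces (ℕ → Act)
  Trace : Set
  Trace = List Act ⊎ (ℕ → Act)

  fin : List Act → Trace
  fin = inj₁

  prepend : List Act → (ℕ → Act) → (ℕ → Act)
  prepend []      w i       = w i
  prepend (a ∷ s) w zero    = a
  prepend (a ∷ s) w (suc i) = prepend s w i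

  _·_ : List Act → Trace → Trace
  s · inj₁ l = inj₁ (s ++ l)
  s · inj₂ w = inj₂ (prepend s w)

  _≼_ : List Act → Trace → Set
  s ≼ f = Σ Trace (λ g → f ≡ s · g)

  Property : Set₁
  Property = Trace → Set

  PosDet : List Act → Property → Set
  PosDet s P = ∀ f → P (s · f)

  NegDet : List Act → Property → Set
  NegDet s P = ∀ f → ¬ P (s · f)

  record MonitoringSystem : Set₁ where
    field
      M        : Set
      nonempty : M
      acc      : M → Trace → Set
      rej      : M → Trace → Set
      acc-fin  : ∀ m f → acc m f → Σ (List Act) (λ s → s ≼ f × acc m (fin s))
      rej-fin  : ∀ m f → rej m f → Σ (List Act) (λ s → s ≼ f × rej m (fin s))
      acc-ext  : ∀ m s → acc m (fin s) → ∀ f → acc m (s · f)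
      rej-ext  : ∀ m s → rej m (fin s) → ∀ f → rej m (s · f)

  module _ (S : MonitoringSystem) where
    open MonitoringSystem S

    record MaximalForAll : Set₁ where
      field
        mon     : Property → M
        acc-iff : ∀ P f → (acc (mon P) f → Σ (List Act) (λ s → s ≼ f × PosDet s P))
                        × (Σ (List Act) (λ s → s ≼ f × PosDet s P) → acc (mon P) f)
        rej-iff : ∀ P f → (rej (mon P) f → Σ (List Act) (λ s → s ≼ f × NegDet s P))
                        × (Σ (List Act) (λ s → s ≼ f × NegDet s P) → rej (mon P) f)

    Sound : M → Property → Set
    Sound m P = (∀ f → acc m f → P f) × (∀ f → rej m f → ¬ P f)

-- Positive determination by a prefix of f forces f ∈ P, so m_P is sound.
-- Conversely, if a sound monitor m accepts f, it already accepts a finite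
-- prefix s of f, hence every extension s g, hence (by soundness) every s g lies
-- in P: s positively determines P, and maximality makes m_P accept f.
module Submission where

open import Defs
open import Data.Nat using (ℕ)
open import Data.List using (List)
open import Data.Product using (Σ; _×_; _,_; proj₁; proj₂)
open import Relation.Nullary using (¬_)
open import Relation.Binary.PropositionalEquality using (subst; sym)

module _ {k : ℕ} {P : Property k} where

  PosDet⇒∈ : ∀ {s f} → _≼_ k s f → PosDet k s P → P f
  PosDet⇒∈ (g , f≡sg) det = subst P (sym f≡sg) (det g)

  NegDet⇒∉ : ∀ {s f} → _≼_ k s f → NegDet k s P → ¬ P f
  NegDet⇒∉ (g , f≡sg) det f∈P = det g (subst P f≡sg f∈P)

module _ {k : ℕ} (S : MonitoringSystem k) where
  open MonitoringSystem S

  sound-acc-fin⇒PosDet : ∀ {m P s} → Sound k S m P → acc m (fin k s) → PosDet k s P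
  sound-acc-fin⇒PosDet (acc-sound , _) acc-s g = acc-sound _ (acc-ext _ _ acc-s g)

  sound-rej-fin⇒NegDet : ∀ {m P s} → Sound k S m P → rej m (fin k s) → NegDet k s P
  sound-rej-fin⇒NegDet (_ , rej-sound) rej-s g = rej-sound _ (rej-ext _ _ rej-s g)

  module _ (mx : MaximalForAll k S) (P : Property k) where
    open MaximalForAll mx

    mon-sound : Sound k S (mon P) P
    mon-sound = acc-sound , rej-sound
      where
      acc-sound : ∀ f → acc (mon P) f → P f
      acc-sound f acc-f with proj₁ (acc-iff P f) acc-f
      ... | _ , s≼f , det = PosDet⇒∈ s≼f det

      rej-sound : ∀ f → rej (mon P) f → ¬ P f
      rej-sound f rej-f with proj₁ (rej-iff P f) rej-f
      ... | _ , s≼f , det = NegDet⇒∉ s≼f det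

    sound⇒acc⇒mon-acc : ∀ {m} → Sound k S m P → ∀ f → acc m f → acc (mon P) f
    sound⇒acc⇒mon-acc m-sound f acc-f with acc-fin _ f acc-f
    ... | s , s≼f , acc-s =
      proj₂ (acc-iff P f) (s , s≼f , sound-acc-fin⇒PosDet m-sound acc-s)

    sound⇒rej⇒mon-rej : ∀ {m} → Sound k S m P → ∀ f → rej m f → rej (mon P) f
    sound⇒rej⇒mon-rej m-sound f rej-f with rej-fin _ f rej-f
    ... | s , s≼f , rej-s =
      proj₂ (rej-iff P f) (s , s≼f , sound-rej-fin⇒NegDet m-sound rej-s)

lemma2 : (k : ℕ) (S : MonitoringSystem k) (mx : MaximalForAll k S) (P : Property k) →
    Sound k S (MaximalForAll.mon mx P) P
    × (∀ (m : MonitoringSystem.M S) → Sound k S m P → ∀ f →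
        (MonitoringSystem.acc S m f → MonitoringSystem.acc S (MaximalForAll.mon mx P) f)
        × (MonitoringSystem.rej S m f → MonitoringSystem.rej S (MaximalForAll.mon mx P) f))
lemma2 k S mx P =
  mon-sound S mx P ,
  λ m m-sound f → sound⇒acc⇒mon-acc S mx P m-sound f , sound⇒rej⇒mon-rej S mx P m-sound f
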